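{- Let $u,v,w\in W$ and let $\boldsymbol{v}=(s_1,\ldots,s_n)$ be a reduced expression for $v$. Then $$c_{u,v}^w=\sum_{\gamma\in\mathcal{P}(w,\boldsymbol{v})_u}q(\gamma).$$
   Context: $(W,S)$ is a Coxeter system with $S$ finite and length function $\ell$. $X$ is a locally finite regular building of type $(W,S)$ with chamber set $\mathcal{C}$ and Weyl distance $\delta$; regularity means each panel of cotype $\{s\}$ lies in exactly $q_s+1$ chambers. For $c\in\mathcal{C}$, $x\in W$, $\mathcal{C}_x(c)=\{d\in\mathcal{C}:\delta(c,d)=x\}$; it is known that $|\mathcal{C}_u(a)\cap\mathcal{C}_v(b)|$ depends only on $u,v$ and $w=\delta(a,b)$, and this number is denoted $c_{u,v}^w$. A pointed pregallery of type $(s_1,\ldots,s_n)$ (in the Coxeter complex) is a sequence $\gamma=(w_0,s_1,w_1,\ldots,s_n,w_n)$ with $w_j\in W$, $s_j\in S$, such that $w_j\in\{w_{j-1},w_{j-1}s_j\}$ for each $j$, and if $w_{j-1}=w_j$ then $\ell(w_{j-1}s_j)<\ell(w_{j-1})$. It starts at $w_0$ and ends at $\mathrm{end}(\gamma)=w_n$. $\mathcal{P}(w,\boldsymbol{v})_u$ is the set of pointed pregalleries of type $\boldsymbol{v}$ starting at $w$ and ending at $u$. For such $\gamma$ and $s\in S$ let $\alpha_s(\gamma)=|\{j:s_j=s,\ \ell(w_{j-1})<\ell(w_j)\}|$, $\sigma_s(\gamma)=|\{j:s_j=s,\ w_j=w_{j-1}\}|$, and $q(\gamma)=\prod_{s\in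 S}q_s^{\alpha_s(\gamma)}(q_s-1)^{\sigma_s(\gamma)}$. -}

module Defs where

open import Level using (0ℓ)
open import Data.Nat using (ℕ; zero; suc; _+_; _*_; _∸_; _^_; _<_)
open import Data.Nat.Properties using (_<?_)
open import Data.Fin using (Fin)
open import Data.Fin.Properties using () renaming (_≟_ to _≟F_)
open import Data.List using (List; []; _∷_; length; map; foldr; allFin)
open import Data.Nat.ListAction using (product)
open import Data.List.Relation.Unary.Unique.Propositional using (Unique)
open import Data.List.Membership.Propositional using (_∈_)
open import Data.Product using (Σ; ∃; _×_; _,_; proj₁; proj₂)
open import Data.Sum using (_⊎_)
open import Data.Unit using (⊤)
open import Relation.Nullary using (¬_; yes; no)
open import Relation.Binary.PropositionalEquality using (_≡_)
open import Relation.Binary.Definitions using (DecidableEquality)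
open import Algebra.Structures using (IsGroup)
open import Algebra.Bundles using (Group)
open import Function.Bundles using (_⇔_)

pow : {A : Set} → (A → A → A) → A → A → ℕ → A
pow _∙_ ε x zero = ε
pow _∙_ ε x (suc n) = x ∙ pow _∙_ ε x n

-- "A finite set, given by a list L, has cardinality n": P is enumerated by L without repetition
Enumerates : {A : Set} → (A → Set) → List A → Set
Enumerates {A} P L = Unique L × ((x : A) → (x ∈ L) ⇔ P x)

-- A Coxeter system (W,S) with S = {gen i | i : Fin k} finite.
-- (W,S) Coxeter system: S generates W, consists of distinct involutions, and W has the
-- presentation < S | (st)^{m(s,t)} = 1 >, m(s,t) the order of st in W, expressed via
-- the universal property of the presentation.
record CoxeterSystem : Set₁ where
  field
    W    : Set
    _·_  : W → W → W
    e    : W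
    _⁻¹  : W → W
    isGroup : IsGroup _≡_ _·_ e _⁻¹
    _≟W_ : DecidableEquality W
    k    : ℕ
    gen  : Fin k → W
    gen-injective : (s t : Fin k) → gen s ≡ gen t → s ≡ t
    gen-nontrivial : (s : Fin k) → ¬ (gen s ≡ e)
    gen-involution : (s : Fin k) → gen s · gen s ≡ e

  prod : List (Fin k) → W
  prod = foldr (λ s x → gen s · x) e

  field
    generates : (w : W) → ∃ λ (ws : List (Fin k)) → prod ws ≡ w
    presentation : (G : Group 0ℓ 0ℓ) (f : Fin k → Group.Carrier G) →
      ((s t : Fin k) (n : ℕ) → pow _·_ e (gen s · gen t) n ≡ e →
         Group._≈_ G (pow (Group._∙_ G) (Group.ε G) (Group._∙_ G (f s) (f t)) n) (Group.ε G)) →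
      Σ (W → Group.Carrier G) λ φ →
        ((x y : W) → Group._≈_ G (φ (x · y)) (Group._∙_ G (φ x) (φ y))) ×
        ((s : Fin k) → Group._≈_ G (φ (gen s)) (f s))
    ℓ : W → ℕ
    ℓ-attained : (w : W) → ∃ λ (ws : List (Fin k)) → prod ws ≡ w × length ws ≡ ℓ w
    ℓ-minimal  : (w : W) (ws : List (Fin k)) → prod ws ≡ w → Data.Nat._≤_ (ℓ w) (length ws)

  ReducedExpr : List (Fin k) → W → Set
  ReducedExpr ws v = prod ws ≡ v × length ws ≡ ℓ v

  -- Pointed pregalleries (w₀, s₁, w₁, …, sₙ, wₙ) are represented by w₀ together with the
  -- list of steps ((s₁,w₁), …, (sₙ,wₙ)).
  ValidSteps : W → List (Fin k × W) → Set
  ValidSteps wp [] = ⊤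
  ValidSteps wp ((s , wj) ∷ rest) =
    ((wj ≡ wp ⊎ wj ≡ wp · gen s) × (wj ≡ wp → ℓ (wp · gen s) < ℓ wp)) × ValidSteps wj rest

  endFrom : W → List (Fin k × W) → W
  endFrom wp [] = wp
  endFrom wp ((s , wj) ∷ rest) = endFrom wj rest

  -- γ ∈ 𝒫(w, 𝐯)_u  (γ given by its step list, starting at w)
  InP : W → List (Fin k) → W → List (Fin k × W) → Set
  InP w 𝐯 u γ = ValidSteps w γ × map proj₁ γ ≡ 𝐯 × endFrom w γ ≡ u

  α : Fin k → W → List (Fin k × W) → ℕ
  α s wp [] = 0
  α s wp ((sj , wj) ∷ rest) with sj ≟F s | ℓ wp <? ℓ wj
  ... | yes _ | yes _ = suc (α s wj rest)
  ... | _     | _     = α s wj rest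

  σ : Fin k → W → List (Fin k × W) → ℕ
  σ s wp [] = 0
  σ s wp ((sj , wj) ∷ rest) with sj ≟F s | wj ≟W wp
  ... | yes _ | yes _ = suc (σ s wj rest)
  ... | _     | _     = σ s wj rest

  qγ : (Fin k → ℕ) → W → List (Fin k × W) → ℕ
  qγ q w γ = product (map (λ s → (q s ^ α s w γ) * ((q s ∸ 1) ^ σ s w γ)) (allFin k))

-- A building of type (W,S), as a W-metric space (Abramenko–Brown, Def. 5.1)
record Building (Cox : CoxeterSystem) : Set₁ where
  open CoxeterSystem Cox
  field
    Ch : Set
    δ  : Ch → Ch → W
    WD1 : (c d : Ch) → (δ c d ≡ e) ⇔ (c ≡ d)
    WD2 : (c d c' : Ch) (s : Fin k) → δ c' c ≡ gen s →
          (δ c' d ≡ gen s · δ c d ⊎ δ c' d ≡ δ c d) ×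
          (ℓ (gen s · δ c d) ≡ suc (ℓ (δ c d)) → δ c' d ≡ gen s · δ c d)
    WD3 : (c d : Ch) (s : Fin k) → ∃ λ c' → δ c' c ≡ gen s × δ c' d ≡ gen s · δ c d

  𝒞 : W → Ch → Ch → Set
  𝒞 x c d = δ c d ≡ x

-- Regularity with parameters (q_s): the s-panel of c is {c} ∪ 𝒞_s(c), so it has q_s + 1
-- chambers iff 𝒞_s(c) has exactly q_s elements.  (This implies local finiteness.)
Regular : {Cox : CoxeterSystem} → Building Cox → (Fin (CoxeterSystem.k Cox) → ℕ) → Set
Regular {Cox} X q = (c : Building.Ch X) (s : Fin (CoxeterSystem.k Cox)) →
  ∃ λ L → Enumerates (Building.𝒞 X (CoxeterSystem.gen Cox s) c) L × length L ≡ q s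

-- Induction on the reduced word s 𝐯', where v' = prod 𝐯' and ℓ(s v') = ℓ(v') + 1.  A chamber d with
-- δ(b,d) = s v' has exactly one s-neighbour b₁ of b with δ(b₁,d) = v', so the chambers counted by c_{u,v}^w
-- are partitioned over the q_s chambers b₁ ∈ 𝒞_s(b), the part of b₁ being counted by c_{u,v'}^{δ(a,b₁)} with
-- δ(a,b₁) ∈ {w s, w}.  If ℓ(w s) > ℓ(w) every b₁ has δ(a,b₁) = w s; otherwise exactly one does and the other
-- q_s − 1 have δ(a,b₁) = w.  The first step of a pointed pregallery from w splits the weighted sum in the same
-- way: moving to w s has weight q_s on an ascent and 1 on a descent, and staying at w (allowed only on a
-- descent) has weight q_s − 1.  Along the way δ(d,c) = δ(c,d)⁻¹ is derived from the axioms via reduced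
-- galleries, and ℓ(s x) = ℓ(x) ± 1 from the sign character of W.

module Submission where

open import Defs
open import Level using (0ℓ)
open import Algebra.Bundles using (Group; CommutativeRing)
import Algebra.Properties.CommutativeSemigroup as CommutativeSemigroupProperties
import Algebra.Properties.Group as GroupProperties
import Algebra.Properties.Loop as LoopProperties
open import Data.Bool using (Bool; true; false; not; _xor_)
open import Data.Bool.Properties using (xor-∧-commutativeRing; xor-same; not-¬)
open import Data.Fin using (Fin)
open import Data.Fin.Properties using () renaming (_≟_ to _≟F_)
open import Data.List using (List; []; _∷_; [_]; _++_; length; map; filter; reverse; allFin)
open import Data.List.Properties
  using (∷-injectiveˡ; ∷-injectiveʳ; length-++; filter-++; filter-accept; filter-reject;
         map-cong; map-cong-local; unfold-reverse; length-reverse)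
open import Data.List.Membership.Propositional using (_∈_)
open import Data.List.Membership.Propositional.Properties using (∈-filter⁺; ∈-filter⁻; ∈-allFin)
open import Data.List.Relation.Unary.All as All using ()
open import Data.List.Relation.Unary.AllPairs using ([]; _∷_)
open import Data.List.Relation.Unary.Any using (here; there)
open import Data.List.Relation.Unary.Unique.Propositional using (Unique)
open import Data.List.Relation.Unary.Unique.Propositional.Properties using (filter⁺; allFin⁺)
open import Data.Nat using (ℕ; zero; suc; _+_; _*_; _∸_; _^_; _≤_; _<_; s≤s)
open import Data.Nat.ListAction using (sum; product)
open import Data.Nat.Properties
open import Data.Product using (Σ-syntax; ∃-syntax; _×_; _,_; proj₁; proj₂)
open import Data.Product.Properties using (≡-dec)
open import Data.Sum using (_⊎_; inj₁; inj₂)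
open import Data.Unit using (tt)
open import Function using (_∘_)
open import Function.Bundles using (_⇔_; mk⇔; Equivalence)
open import Function.Construct.Composition using (_⇔-∘_)
open import Relation.Binary.Definitions using (DecidableEquality; tri<; tri≈; tri>)
open import Relation.Binary.PropositionalEquality hiding ([_])
open import Relation.Nullary using (¬_; yes; no; contradiction)
open import Relation.Unary using (Decidable)

open CommutativeSemigroupProperties +-commutativeSemigroup using ()
  renaming (interchange to +-interchange; x∙yz≈y∙xz to +-left-comm)
open CommutativeSemigroupProperties *-commutativeSemigroup using () renaming (x∙yz≈y∙xz to *-left-comm)
open Equivalence using (to; from)
open ≡-Reasoning

-- Finite sums and enumerations

module _ {A : Set} where

  sum-map-const : ∀ {f : A → ℕ} c (P : List A) → (∀ {y} → y ∈ P → f y ≡ c) →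
    sum (map f P) ≡ length P * c
  sum-map-const c []      f≡c = refl
  sum-map-const c (y ∷ P) f≡c = cong₂ _+_ (f≡c (here refl)) (sum-map-const c P (f≡c ∘ there))

  sum-map-scaled : ∀ {f g : A → ℕ} c (P : List A) → (∀ y → f y ≡ c * g y) →
    sum (map f P) ≡ c * sum (map g P)
  sum-map-scaled c []      f≡cg = sym (*-zeroʳ c)
  sum-map-scaled c (y ∷ P) f≡cg =
    trans (cong₂ _+_ (f≡cg y) (sum-map-scaled c P f≡cg)) (sym (*-distribˡ-+ c _ _))

  sum-map-+ : ∀ (f g : A → ℕ) (P : List A) →
    sum (map (λ y → f y + g y) P) ≡ sum (map f P) + sum (map g P)
  sum-map-+ f g []      = refl
  sum-map-+ f g (y ∷ P) = trans (cong (f y + g y +_) (sum-map-+ f g P)) (+-interchange (f y) (g y) _ _)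

  sum-map-except-one : ∀ {f : A → ℕ} c {P : List A} {y₀} → Unique P → y₀ ∈ P →
    (∀ {y} → y ∈ P → y ≢ y₀ → f y ≡ c) → sum (map f P) ≡ f y₀ + (length P ∸ 1) * c
  sum-map-except-one {f} c {y ∷ P} (y∉P ∷ _) (here refl) f≡c =
    cong (f y +_) (sum-map-const c P (λ y'∈P → f≡c (there y'∈P) (≢-sym (All.lookup y∉P y'∈P))))
  sum-map-except-one {f} c {y ∷ P} {y₀} (y∉P ∷ uP) (there y₀∈P) f≡c = begin
    f y + sum (map f P)                 ≡⟨ cong₂ _+_ (f≡c (here refl) (All.lookup y∉P y₀∈P))
                                                     (sum-map-except-one c uP y₀∈P (f≡c ∘ there)) ⟩
    c + (f y₀ + (length P ∸ 1) * c)     ≡⟨ +-left-comm c (f y₀) _ ⟩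
    f y₀ + (c + (length P ∸ 1) * c)     ≡⟨ cong (f y₀ +_) (c+pred y₀∈P) ⟩
    f y₀ + length P * c                 ∎
    where
      c+pred : ∀ {x} {Q : List A} → x ∈ Q → c + (length Q ∸ 1) * c ≡ length Q * c
      c+pred {Q = _ ∷ _} _ = refl

  product-map-except-one : ∀ {f g : A → ℕ} c {P : List A} {t₀} → Unique P → t₀ ∈ P →
    (∀ {t} → t ∈ P → t ≢ t₀ → f t ≡ g t) → f t₀ ≡ c * g t₀ →
    product (map f P) ≡ c * product (map g P)
  product-map-except-one {f} {g} c {t ∷ P} (t∉P ∷ _) (here refl) f≡g at-t₀ = begin
    f t * product (map f P)        ≡⟨ cong₂ _*_ at-t₀ (cong product (map-cong-local (All.tabulate others))) ⟩
    c * g t * product (map g P)    ≡⟨ *-assoc c (g t) _ ⟩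
    c * (g t * product (map g P))  ∎
    where
      others : ∀ {t'} → t' ∈ P → f t' ≡ g t'
      others t'∈P = f≡g (there t'∈P) (≢-sym (All.lookup t∉P t'∈P))
  product-map-except-one {f} {g} c {t ∷ P} (t∉P ∷ uP) (there t₀∈P) f≡g at-t₀ = begin
    f t * product (map f P)        ≡⟨ cong₂ _*_ (f≡g (here refl) (All.lookup t∉P t₀∈P))
                                               (product-map-except-one c uP t₀∈P (f≡g ∘ there) at-t₀) ⟩
    g t * (c * product (map g P))  ≡⟨ *-left-comm (g t) c _ ⟩
    c * (g t * product (map g P))  ∎

  product-map-1 : ∀ (P : List A) → product (map (λ _ → 1) P) ≡ 1
  product-map-1 []      = refl
  product-map-1 (_ ∷ P) = trans (+-identityʳ _) (product-map-1 P)

module _ {A : Set} where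

  enumerates-⇔ : ∀ {P Q : A → Set} {L} → (∀ x → P x ⇔ Q x) → Enumerates P L → Enumerates Q L
  enumerates-⇔ P⇔Q (uL , memL) = uL , λ x → P⇔Q x ⇔-∘ memL x

  enumerates-filter : ∀ {P Q : A → Set} (Q? : Decidable Q) {L} → Enumerates P L →
    Enumerates (λ x → P x × Q x) (filter Q? L)
  enumerates-filter Q? (uL , memL) = filter⁺ Q? uL , λ x → mk⇔
    (λ x∈ → let (x∈L , Qx) = ∈-filter⁻ Q? x∈ in to (memL x) x∈L , Qx)
    (λ (Px , Qx) → ∈-filter⁺ Q? (from (memL x) Px) Qx)

  enumerates-[] : ∀ {P : A → Set} {L} → Enumerates P L → (∀ x → ¬ P x) → L ≡ []
  enumerates-[] {L = []}    _          _  = refl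
  enumerates-[] {L = x ∷ _} (_ , memL) ¬P = contradiction (to (memL x) (here refl)) (¬P x)

  enumerates-singleton : ∀ {P : A → Set} {L x₀} → Enumerates P L → P x₀ → (∀ {x} → P x → x ≡ x₀) →
    L ≡ [ x₀ ]
  enumerates-singleton {L = []} {x₀} (_ , memL) Px₀ _ = contradiction (from (memL x₀) Px₀) λ ()
  enumerates-singleton {L = x ∷ []} (_ , memL) _ only = cong [_] (only (to (memL x) (here refl)))
  enumerates-singleton {L = x ∷ y ∷ _} ((x∉ ∷ _) , memL) _ only =
    contradiction (trans (only (to (memL x) (here refl))) (sym (only (to (memL y) (there (here refl))))))
                  (All.lookup x∉ (here refl))

module _ {A B : Set} where

  length-≡-sum-fibres : (R : B → A → Set) (R? : ∀ y → Decidable (R y)) {P : List B} (L : List A) →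
    Unique P → (∀ {x} → x ∈ L → ∃[ y ] y ∈ P × R y x) →
    (∀ {x y y'} → x ∈ L → y ∈ P → y' ∈ P → R y x → R y' x → y ≡ y') →
    length L ≡ sum (map (λ y → length (filter (R? y) L)) P)
  length-≡-sum-fibres R R? {P} [] uP _ _ =
    sym (trans (sum-map-const 0 P (λ _ → refl)) (*-zeroʳ (length P)))
  length-≡-sum-fibres R R? {P} (x ∷ L) uP fibre unique = begin
    suc (length L)
      ≡⟨ cong₂ _+_ (sym exactly-one) (length-≡-sum-fibres R R? L uP (fibre ∘ there) (unique ∘ there)) ⟩
    sum (map (λ y → length (filter (R? y) [ x ])) P) + sum (map (λ y → length (filter (R? y) L)) P)
      ≡⟨ sum-map-+ _ _ P ⟨
    sum (map (λ y → length (filter (R? y) [ x ]) + length (filter (R? y) L)) P)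
      ≡⟨ cong sum (map-cong split P) ⟩
    sum (map (λ y → length (filter (R? y) (x ∷ L))) P) ∎
    where
      split : ∀ y →
        length (filter (R? y) [ x ]) + length (filter (R? y) L) ≡ length (filter (R? y) (x ∷ L))
      split y = sym (trans (cong length (filter-++ (R? y) [ x ] L)) (length-++ (filter (R? y) [ x ])))
      exactly-one : sum (map (λ y → length (filter (R? y) [ x ])) P) ≡ 1
      exactly-one with fibre (here refl)
      ... | y₀ , y₀∈P , Ry₀x = trans
        (sum-map-except-one 0 uP y₀∈P λ {y} y∈P y≢y₀ →
          cong length (filter-reject (R? y) λ Ryx → y≢y₀ (unique (here refl) y∈P y₀∈P Ryx Ry₀x)))
        (cong₂ _+_ (cong length (filter-accept (R? y₀) Ry₀x)) (*-zeroʳ (length P ∸ 1)))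

module _ {A : Set} (_≟_ : DecidableEquality A) where

  tailsAfter : A → List (List A) → List (List A)
  tailsAfter h []            = []
  tailsAfter h ([] ∷ G)      = tailsAfter h G
  tailsAfter h ((x ∷ γ) ∷ G) with x ≟ h
  ... | yes _ = γ ∷ tailsAfter h G
  ... | no  _ = tailsAfter h G

  tailsAfter-≡ : ∀ h γ G → tailsAfter h ((h ∷ γ) ∷ G) ≡ γ ∷ tailsAfter h G
  tailsAfter-≡ h γ G with h ≟ h
  ... | yes _   = refl
  ... | no  h≢h = contradiction refl h≢h

  tailsAfter-≢ : ∀ {x h} γ G → x ≢ h → tailsAfter h ((x ∷ γ) ∷ G) ≡ tailsAfter h G
  tailsAfter-≢ {x} {h} γ G x≢h with x ≟ h
  ... | yes x≡h = contradiction x≡h x≢h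
  ... | no  _   = refl

  ∈-tailsAfter⁻ : ∀ {h γ} G → γ ∈ tailsAfter h G → (h ∷ γ) ∈ G
  ∈-tailsAfter⁻ ([] ∷ G) γ∈ = there (∈-tailsAfter⁻ G γ∈)
  ∈-tailsAfter⁻ {h} ((x ∷ γ') ∷ G) γ∈ with x ≟ h
  ... | no  _    = there (∈-tailsAfter⁻ G γ∈)
  ... | yes refl with γ∈
  ...   | here refl = here refl
  ...   | there γ∈' = there (∈-tailsAfter⁻ G γ∈')

  ∈-tailsAfter⁺ : ∀ {h γ} G → (h ∷ γ) ∈ G → γ ∈ tailsAfter h G
  ∈-tailsAfter⁺ ([] ∷ G) (there hγ∈) = ∈-tailsAfter⁺ G hγ∈
  ∈-tailsAfter⁺ {h} ((x ∷ γ') ∷ G) hγ∈ with x ≟ h | hγ∈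
  ... | yes _   | here refl   = here refl
  ... | yes _   | there hγ∈'  = there (∈-tailsAfter⁺ G hγ∈')
  ... | no  x≢h | here refl   = contradiction refl x≢h
  ... | no  _   | there hγ∈'  = ∈-tailsAfter⁺ G hγ∈'

  tailsAfter⁺ : ∀ {h G} → Unique G → Unique (tailsAfter h G)
  tailsAfter⁺ {G = []}              []        = []
  tailsAfter⁺ {G = [] ∷ G}          (_ ∷ uG)  = tailsAfter⁺ uG
  tailsAfter⁺ {h} {(x ∷ γ) ∷ G} (γ∉ ∷ uG) with x ≟ h
  ... | yes refl =
    All.tabulate (λ γ'∈ γ≡γ' → All.lookup γ∉ (∈-tailsAfter⁻ G γ'∈) (cong (h ∷_) γ≡γ')) ∷ tailsAfter⁺ uG
  ... | no  _    = tailsAfter⁺ uG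

  enumerates-tailsAfter : ∀ {P : List A → Set} {G} h → Enumerates P G →
    Enumerates (λ γ → P (h ∷ γ)) (tailsAfter h G)
  enumerates-tailsAfter {G = G} h (uG , memG) =
    tailsAfter⁺ uG , λ γ → memG (h ∷ γ) ⇔-∘ mk⇔ (∈-tailsAfter⁻ G) (∈-tailsAfter⁺ G)

  sum-map-tailsAfter : ∀ (f : List A → ℕ) {h₁ h₂} → h₁ ≢ h₂ → ∀ G →
    (∀ {γ} → γ ∈ G → ∃[ γ' ] (γ ≡ h₁ ∷ γ' ⊎ γ ≡ h₂ ∷ γ')) →
    sum (map f G) ≡
      sum (map (f ∘ (h₁ ∷_)) (tailsAfter h₁ G)) + sum (map (f ∘ (h₂ ∷_)) (tailsAfter h₂ G))
  sum-map-tailsAfter f h₁≢h₂ [] _ = refl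
  sum-map-tailsAfter f {h₁} {h₂} h₁≢h₂ (γ ∷ G) heads with heads (here refl)
  ... | γ' , inj₁ refl
    rewrite tailsAfter-≡ h₁ γ' G | tailsAfter-≢ γ' G h₁≢h₂ =
      trans (cong (f (h₁ ∷ γ') +_) (sum-map-tailsAfter f h₁≢h₂ G (heads ∘ there)))
            (sym (+-assoc (f (h₁ ∷ γ')) (sum (map (f ∘ (h₁ ∷_)) (tailsAfter h₁ G))) _))
  ... | γ' , inj₂ refl
    rewrite tailsAfter-≡ h₂ γ' G | tailsAfter-≢ γ' G (≢-sym h₁≢h₂) =
      trans (cong (f (h₂ ∷ γ') +_) (sum-map-tailsAfter f h₁≢h₂ G (heads ∘ there)))
            (+-left-comm (f (h₂ ∷ γ')) (sum (map (f ∘ (h₁ ∷_)) (tailsAfter h₁ G))) _)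

-- Length and parity in Coxeter groups

module CoxeterLemmas (Cox : CoxeterSystem) where
  open CoxeterSystem Cox

  group : Group 0ℓ 0ℓ
  group = record { Carrier = W ; _≈_ = _≡_ ; _∙_ = _·_ ; ε = e ; _⁻¹ = _⁻¹ ; isGroup = isGroup }

  open Group group using (assoc; identityˡ; identityʳ)
  open GroupProperties group using (⁻¹-involutive; ⁻¹-anti-homo-∙; inverseʳ-unique; ε⁻¹≈ε; loop)
  open LoopProperties loop using (identityˡ-unique; identityʳ-unique)

  gen-cancel : ∀ s x → gen s · (gen s · x) ≡ x
  gen-cancel s x = begin
    gen s · (gen s · x)  ≡⟨ assoc (gen s) (gen s) x ⟨
    (gen s · gen s) · x  ≡⟨ cong (_· x) (gen-involution s) ⟩
    e · x                ≡⟨ identityˡ x ⟩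
    x                    ∎

  gen⁻¹ : ∀ s → gen s ⁻¹ ≡ gen s
  gen⁻¹ s = sym (inverseʳ-unique (gen s) (gen s) (gen-involution s))

  gen-·-≢ : ∀ s x → gen s · x ≢ x
  gen-·-≢ s x sx≡x = gen-nontrivial s (identityˡ-unique (gen s) x sx≡x)

  ·-gen-≢ : ∀ s x → x · gen s ≢ x
  ·-gen-≢ s x xs≡x = gen-nontrivial s (identityʳ-unique x (gen s) xs≡x)

  gen-·-⁻¹ : ∀ s x → gen s · (x ⁻¹) ≡ (x · gen s) ⁻¹
  gen-·-⁻¹ s x = sym (trans (⁻¹-anti-homo-∙ x (gen s)) (cong (_· (x ⁻¹)) (gen⁻¹ s)))

  gen-·-·-gen⁻¹ : ∀ s x → gen s · ((x · gen s) ⁻¹) ≡ x ⁻¹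
  gen-·-·-gen⁻¹ s x = trans (cong (gen s ·_) (sym (gen-·-⁻¹ s x))) (gen-cancel s (x ⁻¹))

  prod-++ : ∀ xs ys → prod (xs ++ ys) ≡ prod xs · prod ys
  prod-++ []       ys = sym (identityˡ (prod ys))
  prod-++ (s ∷ xs) ys = trans (cong (gen s ·_) (prod-++ xs ys)) (sym (assoc (gen s) (prod xs) (prod ys)))

  prod-reverse : ∀ xs → prod (reverse xs) ≡ prod xs ⁻¹
  prod-reverse []       = sym ε⁻¹≈ε
  prod-reverse (s ∷ xs) = begin
    prod (reverse (s ∷ xs))
      ≡⟨ cong prod (unfold-reverse s xs) ⟩
    prod (reverse xs ++ [ s ])
      ≡⟨ prod-++ (reverse xs) [ s ] ⟩
    prod (reverse xs) · (gen s · e)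
      ≡⟨ cong₂ _·_ (prod-reverse xs) (trans (identityʳ (gen s)) (sym (gen⁻¹ s))) ⟩
    (prod xs ⁻¹) · (gen s ⁻¹)
      ≡⟨ ⁻¹-anti-homo-∙ (gen s) (prod xs) ⟨
    (gen s · prod xs) ⁻¹ ∎

  ℓ-⁻¹-≤ : ∀ x → ℓ (x ⁻¹) ≤ ℓ x
  ℓ-⁻¹-≤ x with ℓ-attained x
  ... | ws , refl , |ws| =
    subst (ℓ (prod ws ⁻¹) ≤_) (trans (length-reverse ws) |ws|) (ℓ-minimal _ (reverse ws) (prod-reverse ws))

  ℓ-⁻¹ : ∀ x → ℓ (x ⁻¹) ≡ ℓ x
  ℓ-⁻¹ x = ≤-antisym (ℓ-⁻¹-≤ x) (subst (λ y → ℓ y ≤ ℓ (x ⁻¹)) (⁻¹-involutive x) (ℓ-⁻¹-≤ (x ⁻¹)))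

  ℓ-gen-·-≤ : ∀ s x → ℓ (gen s · x) ≤ suc (ℓ x)
  ℓ-gen-·-≤ s x with ℓ-attained x
  ... | ws , refl , |ws| = subst (ℓ (gen s · prod ws) ≤_) (cong suc |ws|) (ℓ-minimal _ (s ∷ ws) refl)

  -- Sending every generator to true respects the Coxeter relations, as (true xor true)ⁿ = false.
  sign-character : Σ[ sign ∈ (W → Bool) ]
    (∀ x y → sign (x · y) ≡ sign x xor sign y) × (∀ s → sign (gen s) ≡ true)
  sign-character =
    presentation (CommutativeRing.+-group xor-∧-commutativeRing) (λ _ → true) (λ _ _ n _ → pow-false n)
    where
      pow-false : ∀ n → pow _xor_ false false n ≡ false
      pow-false zero    = refl
      pow-false (suc n) = pow-false n

  sign : W → Bool
  sign = proj₁ sign-character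

  sign-· : ∀ x y → sign (x · y) ≡ sign x xor sign y
  sign-· = proj₁ (proj₂ sign-character)

  sign-gen : ∀ s → sign (gen s) ≡ true
  sign-gen = proj₂ (proj₂ sign-character)

  odd : ℕ → Bool
  odd zero    = false
  odd (suc n) = not (odd n)

  sign-prod : ∀ ws → sign (prod ws) ≡ odd (length ws)
  sign-prod []       = trans (cong sign (sym (identityˡ e))) (trans (sign-· e e) (xor-same (sign e)))
  sign-prod (s ∷ ws) = trans (sign-· (gen s) (prod ws)) (cong₂ _xor_ (sign-gen s) (sign-prod ws))

  sign-ℓ : ∀ x → sign x ≡ odd (ℓ x)
  sign-ℓ x with ℓ-attained x
  ... | ws , refl , |ws| = trans (sign-prod ws) (cong odd |ws|)

  ℓ-gen-·-≢ : ∀ s x → ℓ (gen s · x) ≢ ℓ x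
  ℓ-gen-·-≢ s x ℓsx≡ℓx = not-¬ refl (sym (begin
    not (sign x)             ≡⟨ cong (_xor sign x) (sign-gen s) ⟨
    sign (gen s) xor sign x  ≡⟨ sign-· (gen s) x ⟨
    sign (gen s · x)         ≡⟨ sign-ℓ (gen s · x) ⟩
    odd (ℓ (gen s · x))      ≡⟨ cong odd ℓsx≡ℓx ⟩
    odd (ℓ x)                ≡⟨ sign-ℓ x ⟨
    sign x                   ∎))

  ℓ-gen-· : ∀ s x → ℓ (gen s · x) ≡ suc (ℓ x) ⊎ ℓ x ≡ suc (ℓ (gen s · x))
  ℓ-gen-· s x with <-cmp (ℓ (gen s · x)) (ℓ x)
  ... | tri< sx<x _ _ = inj₂ (≤-antisym
          (subst (λ y → ℓ y ≤ suc (ℓ (gen s · x))) (gen-cancel s x) (ℓ-gen-·-≤ s (gen s · x))) sx<x)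
  ... | tri≈ _ sx≡x _ = contradiction sx≡x (ℓ-gen-·-≢ s x)
  ... | tri> _ _ x<sx = inj₁ (≤-antisym (ℓ-gen-·-≤ s x) x<sx)

  ℓ-gen-·-⁻¹ : ∀ s x → ℓ (gen s · (x ⁻¹)) ≡ ℓ (x · gen s)
  ℓ-gen-·-⁻¹ s x = trans (cong ℓ (gen-·-⁻¹ s x)) (ℓ-⁻¹ (x · gen s))

  ℓ-·-gen : ∀ s x → ℓ (x · gen s) ≡ suc (ℓ x) ⊎ ℓ x ≡ suc (ℓ (x · gen s))
  ℓ-·-gen s x with ℓ-gen-· s (x ⁻¹)
  ... | inj₁ ascent  = inj₁ (subst₂ (λ m n → m ≡ suc n) (ℓ-gen-·-⁻¹ s x) (ℓ-⁻¹ x) ascent)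
  ... | inj₂ descent = inj₂ (subst₂ (λ m n → m ≡ suc n) (ℓ-⁻¹ x) (ℓ-gen-·-⁻¹ s x) descent)

  Reduced : List (Fin k) → Set
  Reduced xs = length xs ≡ ℓ (prod xs)

  reduced-ascent : ∀ s xs → Reduced (s ∷ xs) → ℓ (gen s · prod xs) ≡ suc (ℓ (prod xs))
  reduced-ascent s xs red =
    ≤-antisym (ℓ-gen-·-≤ s (prod xs)) (subst (suc (ℓ (prod xs)) ≤_) red (s≤s (ℓ-minimal _ xs refl)))

  reduced-tail : ∀ s xs → Reduced (s ∷ xs) → Reduced xs
  reduced-tail s xs red = suc-injective (trans red (reduced-ascent s xs red))

-- Pregalleries

module Pregalleries (Cox : CoxeterSystem) where
  open CoxeterSystem Cox
  open CoxeterLemmas Cox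

  Pregallery : Set
  Pregallery = List (Fin k × W)

  module _ (q : Fin k → ℕ) where

    weight : W → Pregallery → Fin k → ℕ
    weight w γ t = q t ^ α t w γ * (q t ∸ 1) ^ σ t w γ

    weight-∷-≢ : ∀ w x γ {s t} → s ≢ t → weight w ((s , x) ∷ γ) t ≡ weight x γ t
    weight-∷-≢ w x γ {s} {t} s≢t with s ≟F t | ℓ w <? ℓ x | x ≟W w
    ... | yes s≡t | _ | _ = contradiction s≡t s≢t
    ... | no _    | _ | _ = refl

    weight-∷-ascent : ∀ w x γ {s} → ℓ w < ℓ x → x ≢ w → weight w ((s , x) ∷ γ) s ≡ q s * weight x γ s
    weight-∷-ascent w x γ {s} w<x x≢w with s ≟F s | ℓ w <? ℓ x | x ≟W w
    ... | yes _  | yes _  | no _    = *-assoc (q s) (q s ^ α s x γ) _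
    ... | no s≢s | _      | _       = contradiction refl s≢s
    ... | _      | no w≮x | _       = contradiction w<x w≮x
    ... | _      | _      | yes x≡w = contradiction x≡w x≢w

    weight-∷-descent : ∀ w x γ {s} → ℓ x < ℓ w → weight w ((s , x) ∷ γ) s ≡ weight x γ s
    weight-∷-descent w x γ {s} x<w with s ≟F s | ℓ w <? ℓ x | x ≟W w
    ... | yes _  | no _    | no _    = refl
    ... | no s≢s | _       | _       = contradiction refl s≢s
    ... | _      | yes w<x | _       = contradiction w<x (<-asym x<w)
    ... | _      | _       | yes x≡w = contradiction (cong ℓ x≡w) (<⇒≢ x<w)

    weight-∷-stay : ∀ w γ {s} → weight w ((s , w) ∷ γ) s ≡ (q s ∸ 1) * weight w γ s
    weight-∷-stay w γ {s} with s ≟F s | ℓ w <? ℓ w | w ≟W w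
    ... | yes _  | no _    | yes _  = *-left-comm (q s ^ α s w γ) (q s ∸ 1) _
    ... | no s≢s | _       | _      = contradiction refl s≢s
    ... | _      | yes w<w | _      = contradiction w<w (<-irrefl refl)
    ... | _      | _       | no w≢w = contradiction refl w≢w

    -- Only the factor of the generator s used by the first step changes.
    qγ-∷ : ∀ {w s x} γ c → weight w ((s , x) ∷ γ) s ≡ c * weight x γ s →
      qγ q w ((s , x) ∷ γ) ≡ c * qγ q x γ
    qγ-∷ {w} {s} {x} γ c at-s =
      product-map-except-one c (allFin⁺ k) (∈-allFin s) (λ _ t≢s → weight-∷-≢ w x γ {s} (≢-sym t≢s)) at-s

    qγ-∷-ascent : ∀ {w s x} γ → ℓ w < ℓ x → x ≢ w → qγ q w ((s , x) ∷ γ) ≡ q s * qγ q x γ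
    qγ-∷-ascent {w} {s} {x} γ w<x x≢w = qγ-∷ γ (q s) (weight-∷-ascent w x γ w<x x≢w)

    qγ-∷-descent : ∀ {w s x} γ → ℓ x < ℓ w → qγ q w ((s , x) ∷ γ) ≡ qγ q x γ
    qγ-∷-descent {w} {s} {x} γ x<w = trans
      (qγ-∷ {w} {s} {x} γ 1 (trans (weight-∷-descent w x γ x<w) (sym (*-identityˡ _))))
      (*-identityˡ _)

    qγ-∷-stay : ∀ {w s} γ → qγ q w ((s , w) ∷ γ) ≡ (q s ∸ 1) * qγ q w γ
    qγ-∷-stay {w} {s} γ = qγ-∷ γ (q s ∸ 1) (weight-∷-stay w γ)

    qγ-[] : ∀ w → qγ q w [] ≡ 1
    qγ-[] w = product-map-1 (allFin k)

  module _ {u w : W} {s : Fin k} {𝐯 : List (Fin k)} where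

    InP-move : ∀ {γ} → InP w (s ∷ 𝐯) u ((s , w · gen s) ∷ γ) ⇔ InP (w · gen s) 𝐯 u γ
    InP-move = mk⇔
      (λ ((_ , valid) , types , end) → valid , ∷-injectiveʳ types , end)
      (λ (valid , types , end) →
        ((inj₂ refl , λ ws≡w → contradiction ws≡w (·-gen-≢ s w)) , valid) , cong (s ∷_) types , end)

    InP-stay : ∀ {γ} → InP w (s ∷ 𝐯) u ((s , w) ∷ γ) ⇔ (ℓ (w · gen s) < ℓ w × InP w 𝐯 u γ)
    InP-stay = mk⇔
      (λ (((_ , descent) , valid) , types , end) → descent refl , valid , ∷-injectiveʳ types , end)
      (λ (descent , valid , types , end) →
        ((inj₁ refl , λ _ → descent) , valid) , cong (s ∷_) types , end)

    InP-first-step : ∀ {γ} → InP w (s ∷ 𝐯) u γ →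
      ∃[ γ' ] (γ ≡ (s , w · gen s) ∷ γ' ⊎ γ ≡ (s , w) ∷ γ')
    InP-first-step {[]} (_ , () , _)
    InP-first-step {(s' , x) ∷ γ'} (((x≡ , _) , _) , types , _) with ∷-injectiveˡ types | x≡
    ... | refl | inj₁ refl = γ' , inj₂ refl
    ... | refl | inj₂ refl = γ' , inj₁ refl

    module _ (q : Fin k → ℕ) {G : List Pregallery} (enumG : Enumerates (InP w (s ∷ 𝐯) u) G) where

      private
        _≟step_ : DecidableEquality (Fin k × W)
        _≟step_ = ≡-dec _≟F_ _≟W_

        moves stays : List Pregallery
        moves = tailsAfter _≟step_ (s , w · gen s) G
        stays = tailsAfter _≟step_ (s , w) G

        moves-enumerate : Enumerates (InP (w · gen s) 𝐯 u) moves
        moves-enumerate = enumerates-⇔ (λ _ → InP-move) (enumerates-tailsAfter _≟step_ _ enumG)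

        stays-enumerate : Enumerates (λ γ → ℓ (w · gen s) < ℓ w × InP w 𝐯 u γ) stays
        stays-enumerate = enumerates-⇔ (λ _ → InP-stay) (enumerates-tailsAfter _≟step_ _ enumG)

        sum-by-first-step : sum (map (qγ q w) G) ≡
          sum (map (qγ q w ∘ ((s , w · gen s) ∷_)) moves) + sum (map (qγ q w ∘ ((s , w) ∷_)) stays)
        sum-by-first-step = sum-map-tailsAfter _≟step_ (qγ q w) (λ eq → ·-gen-≢ s w (cong proj₂ eq)) G
          (λ γ∈G → InP-first-step (to (proj₂ enumG _) γ∈G))

      pregalleries-ascent : ℓ w < ℓ (w · gen s) →
        Σ[ G' ∈ List Pregallery ] Enumerates (InP (w · gen s) 𝐯 u) G' ×
          sum (map (qγ q w) G) ≡ q s * sum (map (qγ q (w · gen s)) G')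
      pregalleries-ascent w<ws = moves , moves-enumerate , (begin
        sum (map (qγ q w) G)
          ≡⟨ sum-by-first-step ⟩
        sum (map (qγ q w ∘ ((s , w · gen s) ∷_)) moves) + sum (map (qγ q w ∘ ((s , w) ∷_)) stays)
          ≡⟨ cong₂ _+_ (sum-map-scaled (q s) moves (λ γ → qγ-∷-ascent q {w} {s} γ w<ws (·-gen-≢ s w)))
                       (cong (sum ∘ map _) no-stays) ⟩
        q s * sum (map (qγ q (w · gen s)) moves) + 0
          ≡⟨ +-identityʳ _ ⟩
        q s * sum (map (qγ q (w · gen s)) moves) ∎)
        where
          no-stays : stays ≡ []
          no-stays = enumerates-[] stays-enumerate (λ _ (ws<w , _) → <-asym w<ws ws<w)

      pregalleries-descent : ℓ (w · gen s) < ℓ w →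
        Σ[ G₁ ∈ List Pregallery ] Σ[ G₀ ∈ List Pregallery ]
          Enumerates (InP (w · gen s) 𝐯 u) G₁ × Enumerates (InP w 𝐯 u) G₀ ×
          sum (map (qγ q w) G) ≡ sum (map (qγ q (w · gen s)) G₁) + (q s ∸ 1) * sum (map (qγ q w) G₀)
      pregalleries-descent ws<w =
        moves , stays , moves-enumerate , enumerates-⇔ (λ _ → mk⇔ proj₂ (ws<w ,_)) stays-enumerate ,
        trans sum-by-first-step
          (cong₂ _+_ (cong sum (map-cong (λ γ → qγ-∷-descent q {w} {s} γ ws<w) moves))
                     (sum-map-scaled (q s ∸ 1) stays (qγ-∷-stay q {w} {s})))

-- Buildings

module BuildingLemmas {Cox : CoxeterSystem} (X : Building Cox) where
  open CoxeterSystem Cox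
  open Building X
  open CoxeterLemmas Cox
  open Group group using (identityʳ)
  open GroupProperties group using (⁻¹-involutive)

  δ-refl : ∀ c → δ c c ≡ e
  δ-refl c = from (WD1 c c) refl

  δ≡e⇒≡ : ∀ {c d} → δ c d ≡ e → c ≡ d
  δ≡e⇒≡ {c} {d} = to (WD1 c d)

  δ-neighbour : ∀ {c c' d s} → δ c' c ≡ gen s →
    δ c' d ≡ gen s · δ c d ⊎ (δ c' d ≡ δ c d × ℓ (gen s · δ c d) < ℓ (δ c d))
  δ-neighbour {c} {c'} {d} {s} c'~c with WD2 c d c' s c'~c
  ... | inj₁ moved  , _            = inj₁ moved
  ... | inj₂ stayed , ascent⇒moved = inj₂ (stayed , descent)
    where
      descent : ℓ (gen s · δ c d) < ℓ (δ c d)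
      descent with ℓ-gen-· s (δ c d)
      ... | inj₁ ascent  = contradiction (trans (sym (ascent⇒moved ascent)) stayed) (gen-·-≢ s (δ c d))
      ... | inj₂ descent = ≤-reflexive (sym descent)

  δ-neighbour-ascent : ∀ {b b₁ d s y} → δ b b₁ ≡ gen s → δ b₁ d ≡ y → ℓ (gen s · y) ≡ suc (ℓ y) →
    δ b d ≡ gen s · y
  δ-neighbour-ascent {b} {b₁} {d} {s} b~b₁ refl = proj₂ (WD2 b₁ d b s b~b₁)

  δ-sym-gen : ∀ {c c' s} → δ c c' ≡ gen s → δ c' c ≡ gen s
  δ-sym-gen {c} {c'} {s} c~c' with δ-neighbour {c'} {c} {c} c~c'
  ... | inj₁ moved = begin
    δ c' c                    ≡⟨ gen-cancel s (δ c' c) ⟨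
    gen s · (gen s · δ c' c)  ≡⟨ cong (gen s ·_) (trans (sym moved) (δ-refl c)) ⟩
    gen s · e                 ≡⟨ identityʳ (gen s) ⟩
    gen s                     ∎
  ... | inj₂ (stayed , _) =
    contradiction (trans (sym c~c') (trans (cong (δ c) c'≡c) (δ-refl c))) (gen-nontrivial s)
    where
      c'≡c : c' ≡ c
      c'≡c = δ≡e⇒≡ (trans (sym stayed) (δ-refl c))

  Gallery : Ch → List (Fin k) → Ch → Set
  Gallery c []       d = c ≡ d
  Gallery c (s ∷ xs) d = Σ[ c₁ ∈ Ch ] δ c c₁ ≡ gen s × Gallery c₁ xs d

  δ-gallery : ∀ {c d} xs → Reduced xs → Gallery c xs d → δ c d ≡ prod xs
  δ-gallery []       _   refl                = δ-refl _
  δ-gallery (s ∷ xs) red (c₁ , c~c₁ , gal) =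
    δ-neighbour-ascent c~c₁ (δ-gallery xs (reduced-tail s xs red) gal) (reduced-ascent s xs red)

  gallery-of-type : ∀ xs {c d} → prod xs ≡ δ c d → Gallery c xs d
  gallery-of-type []       e≡δcd = δ≡e⇒≡ (sym e≡δcd)
  gallery-of-type (s ∷ xs) {c} {d} sxs≡δcd with WD3 c d s
  ... | c₁ , c₁~c , δc₁d = c₁ , δ-sym-gen c₁~c , gallery-of-type xs (begin
    prod xs                    ≡⟨ gen-cancel s (prod xs) ⟨
    gen s · (gen s · prod xs)  ≡⟨ cong (gen s ·_) sxs≡δcd ⟩
    gen s · δ c d              ≡⟨ δc₁d ⟨
    δ c₁ d                     ∎)

  gallery-++ : ∀ {c d f} xs {ys} → Gallery c xs d → Gallery d ys f → Gallery c (xs ++ ys) f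
  gallery-++ []       refl                gal' = gal'
  gallery-++ (s ∷ xs) (c₁ , c~c₁ , gal) gal' = c₁ , c~c₁ , gallery-++ xs gal gal'

  gallery-reverse : ∀ {c d} xs → Gallery c xs d → Gallery d (reverse xs) c
  gallery-reverse []       refl                = refl
  gallery-reverse (s ∷ xs) (c₁ , c~c₁ , gal) = subst (λ ys → Gallery _ ys _) (sym (unfold-reverse s xs))
    (gallery-++ (reverse xs) (gallery-reverse xs gal) (_ , δ-sym-gen c~c₁ , refl))

  δ-⁻¹ : ∀ c d → δ d c ≡ δ c d ⁻¹
  δ-⁻¹ c d with ℓ-attained (δ c d)
  ... | ws , ws≡δcd , |ws| = begin
    δ d c              ≡⟨ δ-gallery (reverse ws) reduced (gallery-reverse ws (gallery-of-type ws ws≡δcd)) ⟩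
    prod (reverse ws)  ≡⟨ prod-reverse ws ⟩
    prod ws ⁻¹         ≡⟨ cong _⁻¹ ws≡δcd ⟩
    δ c d ⁻¹           ∎
    where
      reduced : Reduced (reverse ws)
      reduced = begin
        length (reverse ws)    ≡⟨ length-reverse ws ⟩
        length ws              ≡⟨ |ws| ⟩
        ℓ (δ c d)              ≡⟨ ℓ-⁻¹ (δ c d) ⟨
        ℓ (δ c d ⁻¹)           ≡⟨ cong ℓ (trans (prod-reverse ws) (cong _⁻¹ ws≡δcd)) ⟨
        ℓ (prod (reverse ws))  ∎

  neighbours-adjacent : ∀ {b b₁ b₁' s} → δ b b₁ ≡ gen s → δ b b₁' ≡ gen s → b₁' ≡ b₁ ⊎ δ b₁' b₁ ≡ gen s
  neighbours-adjacent {b} {b₁} {b₁'} {s} b~b₁ b~b₁' with δ-neighbour {b} {b₁'} {b₁} (δ-sym-gen b~b₁')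
  ... | inj₁ moved        = inj₁ (δ≡e⇒≡ (trans moved (trans (cong (gen s ·_) b~b₁) (gen-involution s))))
  ... | inj₂ (stayed , _) = inj₂ (trans stayed b~b₁)

  closer-neighbour : ∀ {b d s y} → δ b d ≡ gen s · y → Σ[ b₁ ∈ Ch ] δ b b₁ ≡ gen s × δ b₁ d ≡ y
  closer-neighbour {b} {d} {s} {y} δbd≡sy with WD3 b d s
  ... | b₁ , b₁~b , δb₁d =
    b₁ , δ-sym-gen b₁~b , trans δb₁d (trans (cong (gen s ·_) δbd≡sy) (gen-cancel s y))

  closer-neighbour-unique : ∀ {b b₁ b₁' d s y} → ℓ (gen s · y) ≡ suc (ℓ y) →
    δ b b₁ ≡ gen s → δ b b₁' ≡ gen s → δ b₁ d ≡ y → δ b₁' d ≡ y → b₁ ≡ b₁'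
  closer-neighbour-unique {b} {b₁} {b₁'} {d} {s} {y} ascent b~b₁ b~b₁' δb₁d δb₁'d
    with neighbours-adjacent b~b₁ b~b₁'
  ... | inj₁ b₁'≡b₁ = sym b₁'≡b₁
  ... | inj₂ b₁'~b₁ =
    contradiction (trans (sym (δ-neighbour-ascent b₁'~b₁ δb₁d ascent)) δb₁'d) (gen-·-≢ s y)

  δ-right-neighbour : ∀ {a b b₁ s} → δ b b₁ ≡ gen s →
    δ a b₁ ≡ δ a b · gen s ⊎ (δ a b₁ ≡ δ a b × ℓ (δ a b · gen s) < ℓ (δ a b))
  δ-right-neighbour {a} {b} {b₁} {s} b~b₁ with δ-neighbour {b} {b₁} {a} (δ-sym-gen b~b₁)
  ... | inj₁ moved = inj₁ (begin
    δ a b₁                    ≡⟨ δ-⁻¹ b₁ a ⟩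
    δ b₁ a ⁻¹                 ≡⟨ cong _⁻¹ (trans moved (cong (gen s ·_) (δ-⁻¹ a b))) ⟩
    (gen s · (δ a b ⁻¹)) ⁻¹   ≡⟨ cong _⁻¹ (gen-·-⁻¹ s (δ a b)) ⟩
    ((δ a b · gen s) ⁻¹) ⁻¹   ≡⟨ ⁻¹-involutive _ ⟩
    δ a b · gen s             ∎)
  ... | inj₂ (stayed , descent) = inj₂ (trans (δ-⁻¹ b₁ a) (trans (cong _⁻¹ stayed) (sym (δ-⁻¹ b a))) ,
    subst₂ _<_ (trans (cong (λ y → ℓ (gen s · y)) (δ-⁻¹ a b)) (ℓ-gen-·-⁻¹ s (δ a b)))
               (trans (cong ℓ (δ-⁻¹ a b)) (ℓ-⁻¹ (δ a b))) descent)

  lower-neighbour : ∀ a b s → Σ[ b₁ ∈ Ch ] δ b b₁ ≡ gen s × δ a b₁ ≡ δ a b · gen s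
  lower-neighbour a b s with closer-neighbour (trans (δ-⁻¹ a b) (sym (gen-·-·-gen⁻¹ s (δ a b))))
  ... | b₁ , b~b₁ , δb₁a = b₁ , b~b₁ , trans (δ-⁻¹ b₁ a) (trans (cong _⁻¹ δb₁a) (⁻¹-involutive _))

  lower-neighbour-unique : ∀ {a b b₁ b₁' s} → ℓ (δ a b) ≡ suc (ℓ (δ a b · gen s)) →
    δ b b₁ ≡ gen s → δ b b₁' ≡ gen s → δ a b₁ ≡ δ a b · gen s → δ a b₁' ≡ δ a b · gen s → b₁ ≡ b₁'
  lower-neighbour-unique {a} {b} {b₁} {b₁'} {s} descent b~b₁ b~b₁' δab₁ δab₁' =
    closer-neighbour-unique ascent b~b₁ b~b₁' (reversed δab₁) (reversed δab₁')
    where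
      reversed : ∀ {c} → δ a c ≡ δ a b · gen s → δ c a ≡ (δ a b · gen s) ⁻¹
      reversed {c} δac = trans (δ-⁻¹ a c) (cong _⁻¹ δac)
      ascent : ℓ (gen s · ((δ a b · gen s) ⁻¹)) ≡ suc (ℓ ((δ a b · gen s) ⁻¹))
      ascent = subst₂ (λ m n → m ≡ suc n)
        (trans (sym (ℓ-⁻¹ (δ a b))) (cong ℓ (sym (gen-·-·-gen⁻¹ s (δ a b)))))
        (sym (ℓ-⁻¹ (δ a b · gen s))) descent

-- Counting chambers

module ChamberCount {Cox : CoxeterSystem} (X : Building Cox) (q : Fin (CoxeterSystem.k Cox) → ℕ)
                    (regular : Regular X q) (a : Building.Ch X) (u : CoxeterSystem.W Cox) where
  open CoxeterSystem Cox
  open Building X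
  open CoxeterLemmas Cox
  open Pregalleries Cox
  open BuildingLemmas X

  CountFormula : List (Fin k) → W → Set
  CountFormula 𝐯 v = ∀ w b → δ a b ≡ w →
    (L : List Ch) → Enumerates (λ d → 𝒞 u a d × 𝒞 v b d) L →
    (G : List Pregallery) → Enumerates (InP w 𝐯 u) G →
    length L ≡ sum (map (qγ q w) G)

  count-[] : CountFormula [] e
  count-[] w b δab L enumL G enumG with w ≟W u
  ... | yes refl = begin
    length L
      ≡⟨ cong length (enumerates-singleton enumL (δab , δ-refl b) (sym ∘ δ≡e⇒≡ ∘ proj₂)) ⟩
    1
      ≡⟨ trans (+-identityʳ _) (qγ-[] q w) ⟨
    sum (map (qγ q w) [ [] ])
      ≡⟨ cong (sum ∘ map (qγ q w)) (enumerates-singleton enumG (tt , refl , refl) only-[]) ⟨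
    sum (map (qγ q w) G) ∎
    where
      only-[] : ∀ {γ} → InP w [] w γ → γ ≡ []
      only-[] {[]}    _            = refl
      only-[] {_ ∷ _} (_ , () , _)
  ... | no w≢u = trans (cong length (enumerates-[] enumL no-chamber))
                       (sym (cong (sum ∘ map (qγ q w)) (enumerates-[] enumG no-pregallery)))
    where
      no-chamber : ∀ d → ¬ (δ a d ≡ u × δ b d ≡ e)
      no-chamber d (δad , δbd) = w≢u (trans (sym δab) (trans (cong (δ a) (δ≡e⇒≡ δbd)) δad))
      no-pregallery : ∀ γ → ¬ InP w [] u γ
      no-pregallery []      (_ , _ , w≡u) = w≢u w≡u
      no-pregallery (_ ∷ _) (_ , () , _)

  module Step {s v 𝐯} (ascent : ℓ (gen s · v) ≡ suc (ℓ v)) (count-𝐯 : CountFormula 𝐯 v)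
              {b L} (enumL : Enumerates (λ d → 𝒞 u a d × 𝒞 (gen s · v) b d) L)
              {P} (enumP : Enumerates (𝒞 (gen s) b) P) (|P| : length P ≡ q s) where

    neighbour : ∀ {b₁} → b₁ ∈ P → δ b b₁ ≡ gen s
    neighbour = to (proj₂ enumP _)

    fibre : Ch → List Ch
    fibre b₁ = filter (λ d → δ b₁ d ≟W v) L

    fibre-count : ∀ {b₁ x} → δ b b₁ ≡ gen s → δ a b₁ ≡ x → ∀ G → Enumerates (InP x 𝐯 u) G →
      length (fibre b₁) ≡ sum (map (qγ q x) G)
    fibre-count {b₁} {x} b~b₁ δab₁ = count-𝐯 x b₁ δab₁ (fibre b₁)
      (enumerates-⇔ (λ d → mk⇔ (λ ((δad , _) , δb₁d) → δad , δb₁d)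
                                (λ (δad , δb₁d) → (δad , δ-neighbour-ascent b~b₁ δb₁d ascent) , δb₁d))
                    (enumerates-filter (λ d → δ b₁ d ≟W v) enumL))

    length-≡-sum-fibre-lengths : length L ≡ sum (map (length ∘ fibre) P)
    length-≡-sum-fibre-lengths =
      length-≡-sum-fibres (λ b₁ d → δ b₁ d ≡ v) (λ b₁ d → δ b₁ d ≟W v) L (proj₁ enumP)
        (λ d∈L → let (b₁ , b~b₁ , δb₁d) = closer-neighbour (proj₂ (to (proj₂ enumL _) d∈L))
                 in b₁ , from (proj₂ enumP b₁) b~b₁ , δb₁d)
        (λ _ b₁∈P b₁'∈P → closer-neighbour-unique ascent (neighbour b₁∈P) (neighbour b₁'∈P))

    count-ascent : ℓ (δ a b · gen s) ≡ suc (ℓ (δ a b)) →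
      ∀ G → Enumerates (InP (δ a b) (s ∷ 𝐯) u) G → length L ≡ sum (map (qγ q (δ a b)) G)
    count-ascent w-ascent G enumG with pregalleries-ascent q enumG (≤-reflexive (sym w-ascent))
    ... | G' , enumG' , sumG = begin
      length L
        ≡⟨ length-≡-sum-fibre-lengths ⟩
      sum (map (length ∘ fibre) P)
        ≡⟨ sum-map-const T P (λ b₁∈P → fibre-count (neighbour b₁∈P) (moves b₁∈P) G' enumG') ⟩
      length P * T
        ≡⟨ cong (_* T) |P| ⟩
      q s * T
        ≡⟨ sumG ⟨
      sum (map (qγ q (δ a b)) G) ∎
      where
        T = sum (map (qγ q (δ a b · gen s)) G')
        moves : ∀ {b₁} → b₁ ∈ P → δ a b₁ ≡ δ a b · gen s
        moves b₁∈P with δ-right-neighbour (neighbour b₁∈P)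
        ... | inj₁ moved         = moved
        ... | inj₂ (_ , descent) = contradiction descent (<-asym (≤-reflexive (sym w-ascent)))

    count-descent : ℓ (δ a b) ≡ suc (ℓ (δ a b · gen s)) →
      ∀ G → Enumerates (InP (δ a b) (s ∷ 𝐯) u) G → length L ≡ sum (map (qγ q (δ a b)) G)
    count-descent w-descent G enumG
      with lower-neighbour a b s | pregalleries-descent q enumG (≤-reflexive (sym w-descent))
    ... | b₀ , b~b₀ , δab₀ | G₁ , G₀ , enumG₁ , enumG₀ , sumG = begin
      length L
        ≡⟨ length-≡-sum-fibre-lengths ⟩
      sum (map (length ∘ fibre) P)
        ≡⟨ sum-map-except-one T₀ (proj₁ enumP) (from (proj₂ enumP b₀) b~b₀) stays ⟩
      length (fibre b₀) + (length P ∸ 1) * T₀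
        ≡⟨ cong₂ (λ m n → m + (n ∸ 1) * T₀) (fibre-count b~b₀ δab₀ G₁ enumG₁) |P| ⟩
      T₁ + (q s ∸ 1) * T₀
        ≡⟨ sumG ⟨
      sum (map (qγ q (δ a b)) G) ∎
      where
        T₀ = sum (map (qγ q (δ a b)) G₀)
        T₁ = sum (map (qγ q (δ a b · gen s)) G₁)
        stays : ∀ {b₁} → b₁ ∈ P → b₁ ≢ b₀ → length (fibre b₁) ≡ T₀
        stays b₁∈P b₁≢b₀ with δ-right-neighbour (neighbour b₁∈P)
        ... | inj₁ moved        =
          contradiction (lower-neighbour-unique w-descent (neighbour b₁∈P) b~b₀ moved δab₀) b₁≢b₀
        ... | inj₂ (stayed , _) = fibre-count (neighbour b₁∈P) stayed G₀ enumG₀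

  count-∷ : ∀ {s v 𝐯} → ℓ (gen s · v) ≡ suc (ℓ v) → CountFormula 𝐯 v → CountFormula (s ∷ 𝐯) (gen s · v)
  count-∷ {s} ascent count-𝐯 _ b refl L enumL G enumG with regular b s | ℓ-·-gen s (δ a b)
  ... | P , enumP , |P| | inj₁ w-ascent  =
    Step.count-ascent ascent count-𝐯 enumL enumP |P| w-ascent G enumG
  ... | P , enumP , |P| | inj₂ w-descent =
    Step.count-descent ascent count-𝐯 enumL enumP |P| w-descent G enumG

  count : ∀ 𝐯 → Reduced 𝐯 → CountFormula 𝐯 (prod 𝐯)
  count []      _   = count-[]
  count (s ∷ 𝐯) red = count-∷ (reduced-ascent s 𝐯 red) (count 𝐯 (reduced-tail s 𝐯 red))

open CoxeterSystem
open Building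

theorem3p6 : (Cox : CoxeterSystem) (X : Building Cox) (q : Fin (k Cox) → ℕ) → Regular X q →
    (u v w : W Cox) (𝐯 : List (Fin (k Cox))) → ReducedExpr Cox 𝐯 v →
    (a b : Ch X) → δ X a b ≡ w →
    (L : List (Ch X)) → Enumerates (λ d → 𝒞 X u a d × 𝒞 X v b d) L →
    (G : List (List (Fin (k Cox) × W Cox))) → Enumerates (InP Cox w 𝐯 u) G →
    length L ≡ sum (map (qγ Cox q w) G)
theorem3p6 Cox X q regular u _ w 𝐯 (refl , reduced) a b δab L enumL G enumG =
  count 𝐯 reduced w b δab L enumL G enumG
  where open ChamberCount X q regular a u
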